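{- For every integer $n\geq 2$, the path $P_n$ on $n$ vertices satisfies $b_{dR}(P_n)=1$.
   Context: All graphs are finite, simple and undirected. For a graph $G=(V,E)$, a double Roman dominating function (DRDF) is a function $f:V\to\{0,1,2,3\}$ such that every vertex $v$ with $f(v)=0$ has at least two neighbors $u$ with $f(u)=2$ or at least one neighbor $w$ with $f(w)=3$, and every vertex $v$ with $f(v)=1$ has at least one neighbor $w$ with $f(w)\geq 2$. The weight of $f$ is $\sum_{u\in V}f(u)$, and the double Roman domination number $\gamma_{dR}(G)$ is the minimum weight of a DRDF on $G$. The double Roman bondage number $b_{dR}(G)$ of a graph $G$ with at least one edge is the minimum cardinality of an edge set $B\subseteq E(G)$ such that $\gamma_{dR}(G-B)>\gamma_{dR}(G)$, where $G-B$ is the spanning subgraph obtained by deleting the edges of $B$. -}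

module Defs where

open import Data.Nat using (ℕ; zero; suc; _+_; _≤_; _<_; _≥_)
open import Data.Fin using (Fin; toℕ)
open import Data.Bool using (Bool; true; false; _∧_; _∨_; not)
import Data.Bool.Properties
import Data.Nat
open import Data.List using (List; length; []; _∷_)
open import Data.Bool.ListAction using (any)
open import Data.List.Relation.Unary.All using (All)
open import Data.List.Relation.Unary.Unique.Propositional using (Unique)
open import Data.Product using (Σ; ∃; _×_; _,_)
open import Data.Sum using (_⊎_)
open import Relation.Binary.PropositionalEquality using (_≡_; _≢_)
open import Relation.Nullary using (¬_; yes; no)
open import Data.Empty using (⊥-elim)
import Data.Nat.Properties
import Relation.Binary.PropositionalEquality
open import Data.Fin.Properties using (_≟_)
open import Relation.Nullary.Decidable using (⌊_⌋)

record Graph (n : ℕ) : Set where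
  field
    adj    : Fin n → Fin n → Bool
    sym    : ∀ u v → adj u v ≡ adj v u
    irrefl : ∀ v → adj v v ≡ false
open Graph public

_~[_]_ : ∀ {n} → Fin n → Graph n → Fin n → Set
u ~[ G ] v = adj G u v ≡ true

pathAdj : ∀ {n} → Fin n → Fin n → Bool
pathAdj i j = ⌊ suc (toℕ i) Data.Nat.≟ toℕ j ⌋ ∨ ⌊ suc (toℕ j) Data.Nat.≟ toℕ i ⌋

pathAdj-sym : ∀ {n} (i j : Fin n) → pathAdj i j ≡ pathAdj j i
pathAdj-sym i j = Data.Bool.Properties.∨-comm ⌊ suc (toℕ i) Data.Nat.≟ toℕ j ⌋ ⌊ suc (toℕ j) Data.Nat.≟ toℕ i ⌋

pathAdj-irrefl : ∀ {n} (i : Fin n) → pathAdj i i ≡ false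
pathAdj-irrefl i with suc (toℕ i) Data.Nat.≟ toℕ i
... | yes p = ⊥-elim (Data.Nat.Properties.1+n≢n p)
... | no _  = Relation.Binary.PropositionalEquality.refl

Path : (n : ℕ) → Graph n
Path n = record { adj = pathAdj ; sym = pathAdj-sym ; irrefl = pathAdj-irrefl }

sumFin : ∀ {n} → (Fin n → ℕ) → ℕ
sumFin {zero}  f = 0
sumFin {suc n} f = f Data.Fin.zero + sumFin (λ i → f (Data.Fin.suc i))

Labelling : ℕ → Set
Labelling n = Fin n → Fin 4

val : ∀ {n} → Labelling n → Fin n → ℕ
val f v = toℕ (f v)

weight : ∀ {n} → Labelling n → ℕ
weight f = sumFin (val f)

record IsDRDF {n} (G : Graph n) (f : Labelling n) : Set where
  field
    cond0 : ∀ v → val f v ≡ 0 →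
              (Σ (Fin n) λ w → v ~[ G ] w × val f w ≡ 3)
              ⊎ (Σ (Fin n) λ u → Σ (Fin n) λ w →
                   u ≢ w × v ~[ G ] u × v ~[ G ] w × val f u ≡ 2 × val f w ≡ 2)
    cond1 : ∀ v → val f v ≡ 1 →
              Σ (Fin n) λ w → v ~[ G ] w × val f w ≥ 2

IsγdR : ∀ {n} → Graph n → ℕ → Set
IsγdR {n} G k =
  (Σ (Labelling n) λ f → IsDRDF G f × weight f ≡ k)
  × (∀ f → IsDRDF G f → k ≤ weight f)

-- An edge set of G: a duplicate-free list of pairs (u , v) with u < v
-- (one representative per unordered edge), each an edge of G.
IsEdgeSet : ∀ {n} → Graph n → List (Fin n × Fin n) → Set
IsEdgeSet G B = Unique B × All (λ { (u , v) → (toℕ u < toℕ v) × u ~[ G ] v }) B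

inB : ∀ {n} → List (Fin n × Fin n) → Fin n → Fin n → Bool
inB B u v = any (λ { (a , b) → (⌊ a ≟ u ⌋ ∧ ⌊ b ≟ v ⌋) ∨ (⌊ a ≟ v ⌋ ∧ ⌊ b ≟ u ⌋) }) B

deleteEdges : ∀ {n} → (G : Graph n) → List (Fin n × Fin n) → Graph n
deleteEdges G B = record
  { adj    = λ u v → adj G u v ∧ not (inB B u v)
  ; sym    = symP
  ; irrefl = λ v → irr v
  }
  where
  open import Relation.Binary.PropositionalEquality using (cong₂; cong; refl; trans)
  inB-sym : ∀ (B : List _) u v → inB B u v ≡ inB B v u
  inB-sym [] u v = refl
  inB-sym ((a , b) ∷ B) u v
    rewrite Data.Bool.Properties.∨-comm (⌊ a ≟ u ⌋ ∧ ⌊ b ≟ v ⌋) (⌊ a ≟ v ⌋ ∧ ⌊ b ≟ u ⌋)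
    = cong (_ ∨_) (inB-sym B u v)
  symP : ∀ u v → (adj G u v ∧ not (inB B u v)) ≡ (adj G v u ∧ not (inB B v u))
  symP u v = cong₂ (λ x y → x ∧ not y) (sym G u v) (inB-sym B u v)
  irr : ∀ v → (adj G v v ∧ not (inB B v v)) ≡ false
  irr v rewrite irrefl G v = refl

-- γ_dR(G - B) > γ_dR(G), where γ_dR(G) = k.
-- (Every DRDF of G - B has weight > k, i.e. γ_dR(G - B) > k.)
Increases : ∀ {n} → Graph n → ℕ → List (Fin n × Fin n) → Set
Increases {n} G k B = ∀ f → IsDRDF (deleteEdges G B) f → k < weight f

IsBondage : ∀ {n} → Graph n → ℕ → Set
IsBondage {n} G b =
  Σ ℕ λ k → IsγdR G k ×
    ((Σ (List (Fin n × Fin n)) λ B → IsEdgeSet G B × Increases G k B × length B ≡ b)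
     × (∀ B → IsEdgeSet G B → Increases G k B → b ≤ length B))

-- A labelling of the path is a DRDF exactly when a left-to-right scan succeeds in which every
-- vertex is checked as soon as its right neighbour is read.  For the rest of the path, the part
-- scanned so far matters only through one of five interfaces (the last vertex still needs a 3,
-- still needs a label ≥ 2, offers a 2, offers a 3, or none of these), and a table of lower bounds
-- on the remaining weight, periodic with period 3, is respected by every scan step.  With the
-- labelling 0,3,0,0,3,0,… this gives γ_dR(P_n) = n + [3 ∤ n].  Deleting no edge leaves γ_dR
-- unchanged, while deleting {0,1}, or {1,2} when n ≡ 1 (mod 3), splits P_n into P_1 + P_(n-1),
-- resp. P_2 + P_(n-2), whose values of γ_dR add up to more than γ_dR(P_n).

module Submission where

open import Defs hiding (sym)
open import Data.Nat using (ℕ; zero; suc; _+_; _≤_; _<_; _≥_; _≟_; _≤?_; _≤ᵇ_; z≤n; s≤s)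
open import Data.Nat.Properties
  using (≤-reflexive; ≤-trans; <-≤-trans; <-irrefl; +-monoʳ-≤; +-mono-≤; ≤ᵇ⇒≤; +-assoc; +-commutativeSemigroup)
open import Algebra.Properties.CommutativeSemigroup +-commutativeSemigroup using (x∙yz≈y∙xz)
open import Data.Fin using (Fin; zero; suc; toℕ; inject₁; _↑ˡ_; _↑ʳ_; splitAt)
import Data.Fin as Fin
open import Data.Fin.Patterns using (0F; 1F; 2F; 3F)
open import Data.Fin.Properties using (all?; suc-injective; splitAt⁻¹-↑ˡ; splitAt⁻¹-↑ʳ)
open import Data.Bool using (Bool; true; false; T; not; _∧_; _∨_)
open import Data.Bool.Properties using (T-∨; T-∧; ∧-identityʳ)
open import Data.Maybe using (Maybe; just; nothing; maybe′; map)
open import Data.Maybe.Properties using (map-∘; map-injective; just-injective)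
open import Data.Unit using (tt)
open import Data.Empty using (⊥-elim)
open import Data.List using (List; []; _∷_; length)
open import Data.List.Relation.Unary.All using ([]; _∷_)
open import Data.List.Relation.Unary.AllPairs using ([]; _∷_)
open import Data.Product using (Σ; _×_; _,_; proj₁; proj₂)
open import Data.Product.Function.NonDependent.Propositional using (_×-⇔_)
open import Data.Sum using (_⊎_; inj₁; inj₂)
import Data.Sum as Sum
open import Function using (_∘_; id)
open import Function.Bundles using (_⇔_; mk⇔; Equivalence)
open import Function.Properties.Equivalence using () renaming (refl to ⇔-refl; trans to ⇔-trans; sym to ⇔-sym)
open import Relation.Unary using (Decidable)
open import Relation.Nullary using (¬_)
open import Relation.Nullary.Decidable using (Dec; ⌊_⌋; isYes≗does; toWitness; fromWitness; T?; map′; _×-dec_)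
open import Relation.Binary.PropositionalEquality using (_≡_; _≢_; refl; sym; trans; cong; cong₂; subst)

open Equivalence using (to; from)

pathAdj-suc : ∀ {n} (v w : Fin n) → pathAdj {suc n} (suc v) (suc w) ≡ pathAdj v w
pathAdj-suc v w = cong₂ _∨_ (⌊≟⌋-suc (suc (toℕ v)) (toℕ w)) (⌊≟⌋-suc (suc (toℕ w)) (toℕ v))
  where
  ⌊≟⌋-suc : ∀ m k → ⌊ suc m ≟ suc k ⌋ ≡ ⌊ m ≟ k ⌋
  ⌊≟⌋-suc m k = trans (isYes≗does (suc m ≟ suc k)) (sym (isYes≗does (m ≟ k)))

successor : ∀ {n} → Fin n → Maybe (Fin n)
successor {suc zero}    zero    = nothing
successor {suc (suc n)} zero    = just 1F
successor               (suc v) = map suc (successor v)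

predecessor : ∀ {n} → Fin n → Maybe (Fin n)
predecessor zero    = nothing
predecessor (suc v) = just (inject₁ v)

successor-inject₁ : ∀ {n} (v : Fin n) → successor (inject₁ v) ≡ just (suc v)
successor-inject₁ {suc n} zero    = refl
successor-inject₁         (suc v) = cong (map suc) (successor-inject₁ v)

successor-adjacent : ∀ {n} (v : Fin n) {w} → successor v ≡ just w → v ~[ Path n ] w
successor-adjacent {suc (suc n)} zero refl = refl
successor-adjacent (suc v) eq with successor v in e | eq
... | just u | refl = trans (pathAdj-suc v u) (successor-adjacent v e)

predecessor-adjacent : ∀ {n} (v : Fin n) {w} → predecessor v ≡ just w → v ~[ Path n ] w
predecessor-adjacent (suc v) refl =
  trans (pathAdj-sym (suc v) (inject₁ v)) (successor-adjacent (inject₁ v) (successor-inject₁ v))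

predecessor-suc : ∀ {n} (v : Fin n) {w} → predecessor v ≡ just w → predecessor (suc v) ≡ just (suc w)
predecessor-suc (suc v) refl = refl

adjacent⇒neighbour : ∀ {n} (v w : Fin n) → v ~[ Path n ] w → predecessor v ≡ just w ⊎ successor v ≡ just w
adjacent⇒neighbour zero       (suc zero) _ = inj₂ refl
adjacent⇒neighbour (suc zero) zero       _ = inj₁ refl
adjacent⇒neighbour (suc v)    (suc w)    a =
  Sum.map (predecessor-suc v) (cong (map suc)) (adjacent⇒neighbour v w (trans (sym (pathAdj-suc v w)) a))

map-suc≢zero : ∀ {n} (m : Maybe (Fin n)) → map Fin.suc m ≢ just 0F
map-suc≢zero (just _) ()
map-suc≢zero nothing  ()

predecessor≢successor : ∀ {n} (v : Fin n) {w} → predecessor v ≡ just w → successor v ≢ just w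
predecessor≢successor (suc zero)    refl s = map-suc≢zero (successor 0F) s
predecessor≢successor (suc (suc v)) refl s = predecessor≢successor (suc v) refl (map-injective suc-injective s)

satisfiesᵇ : {P : ℕ → Set} → Decidable P → Maybe (Fin 4) → Bool
satisfiesᵇ P? = maybe′ (λ x → ⌊ P? (toℕ x) ⌋) false

dominatedᵇ : Fin 4 → Maybe (Fin 4) → Maybe (Fin 4) → Bool
dominatedᵇ 0F l r = (satisfiesᵇ (_≟ 3) l ∨ satisfiesᵇ (_≟ 3) r) ∨ (satisfiesᵇ (_≟ 2) l ∧ satisfiesᵇ (_≟ 2) r)
dominatedᵇ 1F l r = satisfiesᵇ (2 ≤?_) l ∨ satisfiesᵇ (2 ≤?_) r
dominatedᵇ (suc (suc _)) _ _ = true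

-- l is the label of a virtual left neighbour of vertex 0.
leftLabel : ∀ {n} → Maybe (Fin 4) → Labelling n → Fin n → Maybe (Fin 4)
leftLabel l f v = maybe′ (just ∘ f) l (predecessor v)

dominatedAtᵇ : ∀ {n} → Maybe (Fin 4) → Labelling n → Fin n → Bool
dominatedAtᵇ l f v = dominatedᵇ (f v) (leftLabel l f v) (map f (successor v))

LocallyDominated : ∀ {n} → Maybe (Fin 4) → Labelling n → Set
LocallyDominated l f = ∀ v → T (dominatedAtᵇ l f v)

module _ {n} (f : Labelling n) where

  satisfies-map : {P : ℕ → Set} (P? : Decidable P) {m : Maybe (Fin n)} →
                  T (satisfiesᵇ P? (map f m)) → Σ (Fin n) λ w → m ≡ just w × P (val f w)
  satisfies-map P? {just w} t = w , refl , toWitness t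

  map-satisfies : {P : ℕ → Set} (P? : Decidable P) {m : Maybe (Fin n)} {w : Fin n} →
                  m ≡ just w → P (val f w) → T (satisfiesᵇ P? (map f m))
  map-satisfies P? refl p = fromWitness p

  neighbourWithᵇ : {P : ℕ → Set} → Decidable P → Fin n → Bool
  neighbourWithᵇ P? v = satisfiesᵇ P? (map f (predecessor v)) ∨ satisfiesᵇ P? (map f (successor v))

  NeighbourWith : (ℕ → Set) → Fin n → Set
  NeighbourWith P v = Σ (Fin n) λ w → v ~[ Path n ] w × P (val f w)

  twoNeighboursLabelled2ᵇ : Fin n → Bool
  twoNeighboursLabelled2ᵇ v = satisfiesᵇ (_≟ 2) (map f (predecessor v)) ∧ satisfiesᵇ (_≟ 2) (map f (successor v))

  TwoNeighboursLabelled2 : Fin n → Set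
  TwoNeighboursLabelled2 v = Σ (Fin n) λ u → Σ (Fin n) λ w →
    u ≢ w × v ~[ Path n ] u × v ~[ Path n ] w × val f u ≡ 2 × val f w ≡ 2

  neighbourWith : {P : ℕ → Set} (P? : Decidable P) (v : Fin n) → T (neighbourWithᵇ P? v) ⇔ NeighbourWith P v
  neighbourWith {P} P? v = mk⇔ ⇒ ⇐
    where
    ⇒ : T (neighbourWithᵇ P? v) → NeighbourWith P v
    ⇒ t with to T-∨ t
    ... | inj₁ tl = let w , e , p = satisfies-map P? tl in w , predecessor-adjacent v e , p
    ... | inj₂ tr = let w , e , p = satisfies-map P? tr in w , successor-adjacent v e , p
    ⇐ : NeighbourWith P v → T (neighbourWithᵇ P? v)
    ⇐ (w , a , p) = from T-∨ (Sum.map (λ e → map-satisfies P? e p) (λ e → map-satisfies P? e p)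
                                       (adjacent⇒neighbour v w a))

  twoNeighboursLabelled2 : (v : Fin n) → T (twoNeighboursLabelled2ᵇ v) ⇔ TwoNeighboursLabelled2 v
  twoNeighboursLabelled2 v = mk⇔ ⇒ ⇐
    where
    ⇒ : T (twoNeighboursLabelled2ᵇ v) → TwoNeighboursLabelled2 v
    ⇒ t with to T-∧ t
    ... | tl , tr with satisfies-map (_≟ 2) tl | satisfies-map (_≟ 2) tr
    ... | u , eu , pu | w , ew , pw =
      u , w , (λ { refl → predecessor≢successor v eu ew }) ,
      predecessor-adjacent v eu , successor-adjacent v ew , pu , pw
    ⇐ : TwoNeighboursLabelled2 v → T (twoNeighboursLabelled2ᵇ v)
    ⇐ (u , w , u≢w , au , aw , pu , pw) with adjacent⇒neighbour v u au | adjacent⇒neighbour v w aw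
    ... | inj₁ eu | inj₁ ew = ⊥-elim (u≢w (just-injective (trans (sym eu) ew)))
    ... | inj₂ eu | inj₂ ew = ⊥-elim (u≢w (just-injective (trans (sym eu) ew)))
    ... | inj₁ eu | inj₂ ew = from T-∧ (map-satisfies (_≟ 2) eu pu , map-satisfies (_≟ 2) ew pw)
    ... | inj₂ eu | inj₁ ew = from T-∧ (map-satisfies (_≟ 2) ew pw , map-satisfies (_≟ 2) eu pu)

  IsDRDF⇔LocallyDominated : IsDRDF (Path n) f ⇔ LocallyDominated nothing f
  IsDRDF⇔LocallyDominated = mk⇔ ⇒ ⇐
    where
    ⇒ : IsDRDF (Path n) f → LocallyDominated nothing f
    ⇒ d v with f v in e
    ... | 0F = from T-∨ (Sum.map (from (neighbourWith (_≟ 3) v)) (from (twoNeighboursLabelled2 v))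
                                 (IsDRDF.cond0 d v (cong toℕ e)))
    ... | 1F = from (neighbourWith (2 ≤?_) v) (IsDRDF.cond1 d v (cong toℕ e))
    ... | suc (suc _) = tt
    ⇐ : LocallyDominated nothing f → IsDRDF (Path n) f
    ⇐ loc = record { cond0 = cond0 ; cond1 = cond1 }
      where
      cond0 : ∀ v → val f v ≡ 0 → NeighbourWith (_≡ 3) v ⊎ TwoNeighboursLabelled2 v
      cond0 v p with f v | loc v
      ... | 0F | t = Sum.map (to (neighbourWith (_≟ 3) v)) (to (twoNeighboursLabelled2 v)) (to T-∨ t)
      cond0 v () | suc _ | _
      cond1 : ∀ v → val f v ≡ 1 → NeighbourWith (2 ≤_) v
      cond1 v p with f v | loc v
      ... | 1F | t = to (neighbourWith (2 ≤?_) v) t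
      cond1 v () | 0F | _
      cond1 v () | suc (suc _) | _

-- Scanning the path from left to right

first : ∀ {n} {A : Set} → (Fin n → A) → Maybe A
first {zero}  _ = nothing
first {suc n} f = just (f zero)

pendingᵇ : Maybe (Fin 4) → Maybe (Fin 4) → Maybe (Fin 4) → Bool
pendingᵇ _ nothing  _ = true
pendingᵇ l (just x) r = dominatedᵇ x l r

-- Scan l p f: a vertex labelled p, with left neighbour labelled l, is followed by the path
-- labelled f, and every vertex is checked once its right neighbour is read; nothing marks an
-- absent vertex.
Scan : ∀ {n} → Maybe (Fin 4) → Maybe (Fin 4) → Labelling n → Set
Scan {zero}  l p f = T (pendingᵇ l p nothing)
Scan {suc n} l p f = T (pendingᵇ l p (just (f zero))) × Scan p (just (f zero)) (f ∘ suc)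

LocallyDominated-uncons : ∀ {n} l (f : Labelling (suc n)) →
  LocallyDominated l f ⇔
  (T (dominatedᵇ (f zero) l (first (f ∘ suc))) × LocallyDominated (just (f zero)) (f ∘ suc))
LocallyDominated-uncons l f = mk⇔ ⇒ ⇐
  where
  successor-zero : ∀ {n} (g : Labelling (suc n)) → map g (successor zero) ≡ first (g ∘ suc)
  successor-zero {zero}  g = refl
  successor-zero {suc n} g = refl
  at-zero : dominatedAtᵇ l f zero ≡ dominatedᵇ (f zero) l (first (f ∘ suc))
  at-zero = cong (dominatedᵇ (f zero) l) (successor-zero f)
  leftLabel-suc : ∀ v → leftLabel l f (suc v) ≡ leftLabel (just (f zero)) (f ∘ suc) v
  leftLabel-suc zero    = refl
  leftLabel-suc (suc v) = refl
  at-suc : ∀ v → dominatedAtᵇ l f (suc v) ≡ dominatedAtᵇ (just (f zero)) (f ∘ suc) v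
  at-suc v = cong₂ (dominatedᵇ (f (suc v))) (leftLabel-suc v) (sym (map-∘ (successor v)))
  ⇒ : LocallyDominated l f →
      T (dominatedᵇ (f zero) l (first (f ∘ suc))) × LocallyDominated (just (f zero)) (f ∘ suc)
  ⇒ loc = subst T at-zero (loc zero) , λ v → subst T (at-suc v) (loc (suc v))
  ⇐ : T (dominatedᵇ (f zero) l (first (f ∘ suc))) × LocallyDominated (just (f zero)) (f ∘ suc) →
      LocallyDominated l f
  ⇐ (h , _)   zero    = subst T (sym at-zero) h
  ⇐ (_ , loc) (suc v) = subst T (sym (at-suc v)) (loc v)

Scan⇔LocallyDominated : ∀ {n} l p (f : Labelling n) →
                        Scan l p f ⇔ (T (pendingᵇ l p (first f)) × LocallyDominated p f)
Scan⇔LocallyDominated {zero}  l p f = mk⇔ (λ t → t , λ ()) proj₁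
Scan⇔LocallyDominated {suc n} l p f =
  ⇔-refl ×-⇔ ⇔-trans (Scan⇔LocallyDominated p (just (f zero)) (f ∘ suc)) (⇔-sym (LocallyDominated-uncons p f))

IsDRDF⇔Scan : ∀ {n} (f : Labelling n) → IsDRDF (Path n) f ⇔ Scan nothing nothing f
IsDRDF⇔Scan f = ⇔-trans (IsDRDF⇔LocallyDominated f)
                        (⇔-sym (⇔-trans (Scan⇔LocallyDominated nothing nothing f) (mk⇔ proj₂ (tt ,_))))

-- The lower bound

data Interface : Set where
  idle needs3 needs≥2 offers2 offers3 : Interface

-- What the last scanned vertex, labelled p with left neighbour l, still needs from or offers to
-- its right neighbour.
interface : Maybe (Fin 4) → Maybe (Fin 4) → Interface
interface _                    nothing   = idle
interface _                    (just 3F) = offers3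
interface _                    (just 2F) = offers2
interface (just 3F)            (just 0F) = idle
interface (just 2F)            (just 0F) = needs≥2
interface _                    (just 0F) = needs3
interface (just (suc (suc _))) (just 1F) = idle
interface _                    (just 1F) = needs≥2

-- A lower bound on the weight of m further vertices completing a scan from a given interface;
-- cost idle n = n + [3 ∤ n].
cost : Interface → ℕ → ℕ
cost s       (suc (suc (suc m))) = 3 + cost s m
cost idle    0 = 0
cost idle    1 = 2
cost idle    2 = 3
cost needs3  0 = 2
cost needs3  1 = 3
cost needs3  2 = 3
cost needs≥2 0 = 1
cost needs≥2 1 = 2
cost needs≥2 2 = 3
cost offers2 0 = 0
cost offers2 1 = 1
cost offers2 2 = 2
cost offers3 0 = 0
cost offers3 1 = 0
cost offers3 2 = 2

∀-maybe? : ∀ {n} {P : Maybe (Fin n) → Set} → Decidable P → Dec (∀ m → P m)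
∀-maybe? P? = map′ (λ { (pn , pj) nothing → pn ; (pn , pj) (just x) → pj x }) (λ h → h nothing , h ∘ just)
                   (P? nothing ×-dec all? (P? ∘ just))

implied : ∀ {a b} → T a → T (not a ∨ b) → T b
implied {true} _ t = t

step-cost-small : ∀ l p x (r : Fin 3) →
  T (not (pendingᵇ l p (just x)) ∨
     (cost (interface l p) (suc (toℕ r)) ≤ᵇ toℕ x + cost (interface p (just x)) (toℕ r)))
step-cost-small = toWitness {a? = ∀-maybe? λ l → ∀-maybe? λ p → all? λ x → all? λ r → T? _} tt

end-cost : ∀ l p → T (not (pendingᵇ l p nothing) ∨ (cost (interface l p) 0 ≤ᵇ 0))
end-cost = toWitness {a? = ∀-maybe? λ l → ∀-maybe? λ p → T? _} tt

step-cost : ∀ l p x m → T (pendingᵇ l p (just x)) →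
            cost (interface l p) (suc m) ≤ toℕ x + cost (interface p (just x)) m
step-cost l p x 0 ok = ≤ᵇ⇒≤ _ _ (implied ok (step-cost-small l p x 0F))
step-cost l p x 1 ok = ≤ᵇ⇒≤ _ _ (implied ok (step-cost-small l p x 1F))
step-cost l p x 2 ok = ≤ᵇ⇒≤ _ _ (implied ok (step-cost-small l p x 2F))
step-cost l p x (suc (suc (suc m))) ok =
  ≤-trans (+-monoʳ-≤ 3 (step-cost l p x m ok)) (≤-reflexive (x∙yz≈y∙xz 3 (toℕ x) _))

Scan⇒cost≤weight : ∀ {n} l p (f : Labelling n) → Scan l p f → cost (interface l p) n ≤ weight f
Scan⇒cost≤weight {zero}  l p f t          = ≤ᵇ⇒≤ _ _ (implied t (end-cost l p))
Scan⇒cost≤weight {suc n} l p f (ok , rest) =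
  ≤-trans (step-cost l p (f zero) n ok)
          (+-monoʳ-≤ (toℕ (f zero)) (Scan⇒cost≤weight p (just (f zero)) (f ∘ suc) rest))

IsDRDF⇒cost≤weight : ∀ {n} (f : Labelling n) → IsDRDF (Path n) f → cost idle n ≤ weight f
IsDRDF⇒cost≤weight f d = Scan⇒cost≤weight nothing nothing f (to (IsDRDF⇔Scan f) d)

pathOptimum : (n : ℕ) → Labelling n
pathOptimum 1                   0F                  = 2F
pathOptimum 2                   0F                  = 0F
pathOptimum 2                   1F                  = 3F
pathOptimum (suc (suc (suc n))) 0F                  = 0F
pathOptimum (suc (suc (suc n))) 1F                  = 3F
pathOptimum (suc (suc (suc n))) 2F                  = 0F
pathOptimum (suc (suc (suc n))) (suc (suc (suc i))) = pathOptimum n i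

left-0-helps-nobody : ∀ x r → dominatedᵇ x (just 0F) r ≡ dominatedᵇ x nothing r
left-0-helps-nobody 0F            r = refl
left-0-helps-nobody 1F            r = refl
left-0-helps-nobody (suc (suc _)) r = refl

Scan-after-block : ∀ {n} (g : Labelling n) → Scan nothing nothing g → Scan (just 3F) (just 0F) g
Scan-after-block {zero}        g _               = tt
Scan-after-block {suc zero}    g (_ , ok)        = tt , subst T (sym (left-0-helps-nobody (g zero) _)) ok
Scan-after-block {suc (suc n)} g (_ , ok , rest) = tt , subst T (sym (left-0-helps-nobody (g zero) _)) ok , rest

pathOptimum-scan : ∀ n → Scan nothing nothing (pathOptimum n)
pathOptimum-scan 0                   = tt
pathOptimum-scan 1                   = tt , tt
pathOptimum-scan 2                   = tt , tt , tt
pathOptimum-scan (suc (suc (suc n))) = tt , tt , tt , Scan-after-block (pathOptimum n) (pathOptimum-scan n)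

pathOptimum-weight : ∀ n → weight (pathOptimum n) ≡ cost idle n
pathOptimum-weight 0                   = refl
pathOptimum-weight 1                   = refl
pathOptimum-weight 2                   = refl
pathOptimum-weight (suc (suc (suc n))) = cong (3 +_) (pathOptimum-weight n)

IsγdR-Path : ∀ n → IsγdR (Path n) (cost idle n)
IsγdR-Path n =
  (pathOptimum n , from (IsDRDF⇔Scan _) (pathOptimum-scan n) , pathOptimum-weight n) , IsDRDF⇒cost≤weight

-- Restricting to induced subgraphs and components

IsDRDF-restrict : ∀ {N m} {G : Graph N} {H : Graph m} (e : Fin m → Fin N) →
  (∀ v w → adj G (e v) (e w) ≡ adj H v w) →
  (∀ v x → e v ~[ G ] x → Σ (Fin m) λ w → e w ≡ x) →
  ∀ {f} → IsDRDF G f → IsDRDF H (f ∘ e)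
IsDRDF-restrict {m = m} {G} {H} e adj-e closed {f} d = record { cond0 = cond0 ; cond1 = cond1 }
  where
  adjacent-preimage : ∀ v x → e v ~[ G ] x → Σ (Fin m) λ w → e w ≡ x × v ~[ H ] w
  adjacent-preimage v x a with closed v x a
  ... | w , refl = w , refl , trans (sym (adj-e v w)) a
  cond0 : ∀ v → val f (e v) ≡ 0 →
          (Σ (Fin m) λ w → v ~[ H ] w × val f (e w) ≡ 3)
          ⊎ (Σ (Fin m) λ u → Σ (Fin m) λ w →
               u ≢ w × v ~[ H ] u × v ~[ H ] w × val f (e u) ≡ 2 × val f (e w) ≡ 2)
  cond0 v p with IsDRDF.cond0 d (e v) p
  ... | inj₁ (x , a , p3) with adjacent-preimage v x a
  ...   | w , refl , aw = inj₁ (w , aw , p3)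
  cond0 v p | inj₂ (x , y , x≢y , ax , ay , px , py) with adjacent-preimage v x ax | adjacent-preimage v y ay
  ... | u , refl , au | w , refl , aw = inj₂ (u , w , (λ u≡w → x≢y (cong e u≡w)) , au , aw , px , py)
  cond1 : ∀ v → val f (e v) ≡ 1 → Σ (Fin m) λ w → v ~[ H ] w × val f (e w) ≥ 2
  cond1 v p with IsDRDF.cond1 d (e v) p
  ... | x , a , p2 with adjacent-preimage v x a
  ...   | w , refl , aw = w , aw , p2

IsDRDF-deleteEdges-[] : ∀ {n} {G : Graph n} {f} → IsDRDF G f → IsDRDF (deleteEdges G []) f
IsDRDF-deleteEdges-[] {G = G} = IsDRDF-restrict id (λ v w → sym (∧-identityʳ (adj G v w))) (λ v x _ → x , refl)

no-increase-without-deletion : ∀ {n} {G : Graph n} {k} → IsγdR G k → ¬ Increases G k []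
no-increase-without-deletion ((f , d , weight≡k) , _) increases =
  <-irrefl (sym weight≡k) (increases f (IsDRDF-deleteEdges-[] d))

sumFin-↑ : ∀ a {b} (g : Fin (a + b) → ℕ) → sumFin g ≡ sumFin (g ∘ (_↑ˡ b)) + sumFin (g ∘ (a ↑ʳ_))
sumFin-↑ zero    g = refl
sumFin-↑ (suc a) g = trans (cong (g zero +_) (sumFin-↑ a (g ∘ suc))) (sym (+-assoc (g zero) _ _))

module _ {a b} {G : Graph (a + b)} {H₁ : Graph a} {H₂ : Graph b}
         (adj-left  : ∀ i j → adj G (i ↑ˡ b) (j ↑ˡ b) ≡ adj H₁ i j)
         (adj-right : ∀ i j → adj G (a ↑ʳ i) (a ↑ʳ j) ≡ adj H₂ i j)
         (adj-cross : ∀ i j → adj G (i ↑ˡ b) (a ↑ʳ j) ≡ false) where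

  IsDRDF-components : ∀ {f} → IsDRDF G f → IsDRDF H₁ (f ∘ (_↑ˡ b)) × IsDRDF H₂ (f ∘ (a ↑ʳ_))
  IsDRDF-components d =
    IsDRDF-restrict (_↑ˡ b) adj-left closed-left d , IsDRDF-restrict (a ↑ʳ_) adj-right closed-right d
    where
    closed-left : ∀ i x → (i ↑ˡ b) ~[ G ] x → Σ (Fin a) λ j → j ↑ˡ b ≡ x
    closed-left i x ax with splitAt a x in eq
    ... | inj₁ j = j , splitAt⁻¹-↑ˡ eq
    ... | inj₂ j with refl ← splitAt⁻¹-↑ʳ eq with () ← trans (sym (adj-cross i j)) ax
    closed-right : ∀ i x → (a ↑ʳ i) ~[ G ] x → Σ (Fin b) λ j → a ↑ʳ j ≡ x
    closed-right i x ax with splitAt a x in eq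
    ... | inj₂ j = j , splitAt⁻¹-↑ʳ eq
    ... | inj₁ j with refl ← splitAt⁻¹-↑ˡ eq with () ← trans (sym (trans (Graph.sym G _ _) (adj-cross j i))) ax

cost-components : ∀ a {b} {f : Labelling (a + b)} →
  IsDRDF (Path a) (f ∘ (_↑ˡ b)) × IsDRDF (Path b) (f ∘ (a ↑ʳ_)) → cost idle a + cost idle b ≤ weight f
cost-components a {f = f} (d₁ , d₂) =
  subst (_ ≤_) (sym (sumFin-↑ a (val f))) (+-mono-≤ (IsDRDF⇒cost≤weight _ d₁) (IsDRDF⇒cost≤weight _ d₂))

-- Deleting one edge

cut-first-edge : ∀ m {f} → IsDRDF (deleteEdges (Path (2 + m)) ((0F , 1F) ∷ [])) f →
                 cost idle 1 + cost idle (1 + m) ≤ weight f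
cut-first-edge m {f} d = cost-components 1 {f = f} (IsDRDF-components adj-left adj-right adj-cross d)
  where
  G : Graph (2 + m)
  G = deleteEdges (Path (2 + m)) ((0F , 1F) ∷ [])
  adj-left : ∀ i j → adj G (i ↑ˡ suc m) (j ↑ˡ suc m) ≡ pathAdj {1} i j
  adj-left 0F 0F = refl
  adj-right : ∀ i j → adj G (suc i) (suc j) ≡ pathAdj i j
  adj-right i j = trans (∧-identityʳ _) (pathAdj-suc i j)
  adj-cross : ∀ i j → adj G (i ↑ˡ suc m) (suc j) ≡ false
  adj-cross 0F 0F      = refl
  adj-cross 0F (suc j) = refl

cut-second-edge : ∀ m {f} → IsDRDF (deleteEdges (Path (4 + m)) ((1F , 2F) ∷ [])) f →
                  cost idle 2 + cost idle (2 + m) ≤ weight f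
cut-second-edge m {f} d = cost-components 2 {f = f} (IsDRDF-components adj-left adj-right adj-cross d)
  where
  G : Graph (4 + m)
  G = deleteEdges (Path (4 + m)) ((1F , 2F) ∷ [])
  adj-left : ∀ i j → adj G (i ↑ˡ suc (suc m)) (j ↑ˡ suc (suc m)) ≡ pathAdj {2} i j
  adj-left 0F 0F = refl
  adj-left 0F 1F = refl
  adj-left 1F 0F = refl
  adj-left 1F 1F = refl
  adj-right : ∀ i j → adj G (suc (suc i)) (suc (suc j)) ≡ pathAdj i j
  adj-right i j = trans (∧-identityʳ _) (trans (pathAdj-suc (suc i) (suc j)) (pathAdj-suc i j))
  adj-cross : ∀ i j → adj G (i ↑ˡ suc (suc m)) (suc (suc j)) ≡ false
  adj-cross 0F j       = refl
  adj-cross 1F 0F      = refl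
  adj-cross 1F (suc j) = refl

cut-gain : ∀ m → cost idle (2 + m) < cost idle 1 + cost idle (1 + m)
               ⊎ Σ ℕ λ k → m ≡ 2 + k × cost idle (4 + k) < cost idle 2 + cost idle (2 + k)
cut-gain 0 = inj₁ (≤ᵇ⇒≤ _ _ tt)
cut-gain 1 = inj₁ (≤ᵇ⇒≤ _ _ tt)
cut-gain 2 = inj₂ (0 , refl , ≤ᵇ⇒≤ _ _ tt)
cut-gain (suc (suc (suc m))) with cut-gain m
... | inj₁ gain             = inj₁ (s≤s (s≤s (s≤s gain)))
... | inj₂ (k , refl , gain) = inj₂ (3 + k , refl , s≤s (s≤s (s≤s gain)))

single-edge-bondage : ∀ m → Σ (List (Fin (2 + m) × Fin (2 + m))) λ B →
  IsEdgeSet (Path (2 + m)) B × Increases (Path (2 + m)) (cost idle (2 + m)) B × length B ≡ 1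
single-edge-bondage m with cut-gain m
... | inj₁ gain = (0F , 1F) ∷ [] , ([] ∷ [] , (s≤s z≤n , refl) ∷ []) ,
                  (λ f d → <-≤-trans gain (cut-first-edge m d)) , refl
... | inj₂ (k , refl , gain) = (1F , 2F) ∷ [] , ([] ∷ [] , (s≤s (s≤s z≤n) , refl) ∷ []) ,
                               (λ f d → <-≤-trans gain (cut-second-edge k d)) , refl

theorem2p1 : (n : ℕ) → n ≥ 2 → IsBondage (Path n) 1
theorem2p1 (suc (suc m)) _ = cost idle (2 + m) , IsγdR-Path (2 + m) , single-edge-bondage m , nonempty
  where
  nonempty : ∀ B → IsEdgeSet (Path (2 + m)) B → Increases (Path (2 + m)) (cost idle (2 + m)) B → 1 ≤ length B
  nonempty []      _ increases = ⊥-elim (no-increase-without-deletion (IsγdR-Path (2 + m)) increases)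
  nonempty (_ ∷ _) _ _         = s≤s z≤n
theorem2p1 (suc zero) (s≤s ())
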